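{- Let $k_A,k_B,\ell$ be integers with $k_A,k_B\ge 2$ and $\ell\ge k_A+k_B-1$. Then the complete bipartite graph $G=(A\cup B,E)$ with $|A|=\binom{\ell}{k_A}$ and $|B|=\overline{M}(k_A-1,k_B,\ell)$ is not $(k_A,k_B)$-choosable.
   Context: For positive integers $k_1,k_2,\ell$, a family $\mathcal F$ of $k_2$-element subsets of $[\ell]=\{1,\dots,\ell\}$ has Property A$(k_1,k_2,\ell)$ if there is a $k_1$-element subset of $[\ell]$ intersecting every set in $\mathcal F$; $\overline{M}(k_1,k_2,\ell)$ is the minimum cardinality of a family of $k_2$-element subsets of $[\ell]$ without Property A$(k_1,k_2,\ell)$. For a bipartite graph $G=(A\cup B,E)$ with designated parts $A,B$, a $(k_A,k_B)$-list-assignment assigns to each vertex of $A$ a set of $k_A$ positive integers and to each vertex of $B$ a set of $k_B$ positive integers; $G$ is $(k_A,k_B)$-choosable if for every such assignment $L$ there is a proper colouring $c$ with $c(v)\in L(v)$ for all $v$. -}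

module Defs where

open import Data.Nat using (ℕ; _≤_; _<_)
open import Data.Fin using (Fin)
open import Data.Fin.Subset using (Subset; ∣_∣; _∩_; Nonempty)
open import Data.Product using (Σ; ∃; _×_; _,_)
open import Data.Unit using (⊤)
open import Function.Definitions using (Injective)
open import Relation.Binary.PropositionalEquality using (_≡_; _≢_)

record Family (m k₂ ℓ : ℕ) : Set where
  field
    set      : Fin m → Subset ℓ
    distinct : Injective _≡_ _≡_ set
    size     : ∀ i → ∣ set i ∣ ≡ k₂
open Family public

PropertyA : (k₁ : ℕ) → ∀ {m k₂ ℓ} → Family m k₂ ℓ → Set
PropertyA k₁ {ℓ = ℓ} F =
  Σ (Subset ℓ) λ T → (∣ T ∣ ≡ k₁) × (∀ i → Nonempty (T ∩ set F i))

IsMbar : ℕ → ℕ → ℕ → ℕ → Set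
IsMbar k₁ k₂ ℓ m =
  (Σ (Family m k₂ ℓ) λ F → ¬A F)
  × (∀ m′ → (F : Family m′ k₂ ℓ) → ¬A F → m ≤ m′)
  where
  ¬A : ∀ {n} → Family n k₂ ℓ → Set
  ¬A F = PropertyA k₁ F → Data.Empty.⊥
    where import Data.Empty

record BipartiteGraph : Set₁ where
  field
    a b : ℕ
    adj : Fin a → Fin b → Set
open BipartiteGraph public

record ListOf (k : ℕ) : Set where
  field
    col      : Fin k → ℕ
    distinct : Injective _≡_ _≡_ col
    positive : ∀ j → 0 < col j
open ListOf public

_∈L_ : ℕ → ∀ {k} → ListOf k → Set
x ∈L L = ∃ λ j → col L j ≡ x

Choosable : ℕ → ℕ → BipartiteGraph → Set
Choosable kA kB G =
  (LA : Fin (a G) → ListOf kA) (LB : Fin (b G) → ListOf kB) →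
  Σ (Fin (a G) → ℕ) λ cA → Σ (Fin (b G) → ℕ) λ cB →
    (∀ u → cA u ∈L LA u) × (∀ v → cB v ∈L LB v)
    × (∀ u v → adj G u v → cA u ≢ cB v)

K : ℕ → ℕ → BipartiteGraph
K x y = record { a = x ; b = y ; adj = λ _ _ → ⊤ }

-- Give the A-vertices the lists {1+x : x ∈ S} for all kA-subsets S of [ℓ], one each, and
-- give B-vertices the members of a family F of kB-subsets of [ℓ] without Property
-- A(kA − 1, kB, ℓ).  In any colouring from these lists, fewer than kA of the colours
-- 1, …, ℓ are unused on A, for otherwise some A-vertex would have only unused colours
-- in its list.  Every B-vertex takes an unused colour, so the (padded) set of unused
-- colours is a (kA − 1)-set meeting every member of F.
module Submission where

open import Defs
open import Data.Nat using (ℕ; _≤_; _+_; _∸_)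
open import Data.Nat.Combinatorics using (_C_)
open import Relation.Nullary using (¬_)

open import Level using (Level)
open import Data.Nat using (zero; suc; z≤n; s≤s; _<_; _≤?_; _≟_)
open import Data.Nat.Properties
  using (≤-trans; ≤-reflexive; m≤m+n; ≰⇒>; ≤-pred; suc-injective; n≤0⇒n≡0)
open import Data.Nat.Combinatorics using (nCk+nC[k+1]≡[n+1]C[k+1])
open import Data.Fin using (Fin; toℕ; cast) renaming (zero to fzero; suc to fsuc)
open import Data.Fin.Properties using (any?; cast-involutive; toℕ-injective)
  renaming (suc-injective to fsuc-injective)
open import Data.Fin.Subset using (Subset; ∣_∣; _∈_; _⊆_; inside; outside)
open import Data.Fin.Subset.Properties using (x∈p∩q⁺; ∣p∣≤n; s⊆s; out⊆)
open import Data.Vec using ([]; _∷_; here; there)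
open import Data.List using (List; []; length; lookup; map; _++_; [_])
open import Data.List.Properties using (length-++; length-map)
open import Data.List.Relation.Unary.Any as Any using (Any; here; index; satisfied)
open import Data.List.Relation.Unary.Any.Properties using (++⁺ˡ; ++⁺ʳ; map⁺; lookup-index)
open import Data.Product using (Σ; ∃; _×_; _,_; proj₁)
open import Data.Unit using (tt)
open import Data.Empty using (⊥-elim)
open import Function using (_∘_; id)
open import Function.Definitions using (Injective)
open import Relation.Nullary using (yes; no; does; ¬?)
open import Relation.Nullary.Decidable using (dec-true)
open import Relation.Unary using (Pred; Decidable)
open import Relation.Binary.PropositionalEquality
  using (_≡_; refl; sym; trans; cong; cong₂; subst; module ≡-Reasoning)
open ≡-Reasoning

private
  variable
    p : Level
    n k : ℕ

subset : {P : Pred (Fin n) p} → Decidable P → Subset n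
subset {n = zero}  P? = []
subset {n = suc n} P? = does (P? fzero) ∷ subset (P? ∘ fsuc)

∈-subset⁺ : {P : Pred (Fin n) p} (P? : Decidable P) {x : Fin n} → P x → x ∈ subset P?
∈-subset⁺ P? {fzero} px rewrite dec-true (P? fzero) px = here
∈-subset⁺ P? {fsuc x} px = there (∈-subset⁺ (P? ∘ fsuc) px)

∈-subset⁻ : {P : Pred (Fin n) p} (P? : Decidable P) {x : Fin n} → x ∈ subset P? → P x
∈-subset⁻ P? {fzero} x∈ with P? fzero | x∈
... | yes px | _ = px
... | no _   | ()
∈-subset⁻ P? {fsuc x} (there x∈) = ∈-subset⁻ (P? ∘ fsuc) x∈

superset-of-size : (D : Subset n) → ∣ D ∣ ≤ k → k ≤ n → ∃ λ T → D ⊆ T × ∣ T ∣ ≡ k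
superset-of-size {k = zero} D ∣D∣≤0 _ = D , id , n≤0⇒n≡0 ∣D∣≤0
superset-of-size {k = suc k} (inside ∷ D) (s≤s ∣D∣≤k) (s≤s k≤n)
  with T , D⊆T , ∣T∣≡k ← superset-of-size D ∣D∣≤k k≤n = inside ∷ T , s⊆s D⊆T , cong suc ∣T∣≡k
superset-of-size {k = suc k} (outside ∷ D) ∣D∣≤1+k (s≤s k≤n) with ∣ D ∣ ≤? k
... | yes ∣D∣≤k with T , D⊆T , ∣T∣≡k ← superset-of-size D ∣D∣≤k k≤n =
  inside ∷ T , out⊆ D⊆T , cong suc ∣T∣≡k
... | no ∣D∣≰k with T , D⊆T , ∣T∣≡1+k ← superset-of-size D ∣D∣≤1+k (≤-trans (≰⇒> ∣D∣≰k) (∣p∣≤n D)) =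
  outside ∷ T , out⊆ D⊆T , ∣T∣≡1+k

propertyA-from-transversal : ∀ {m k₁ k₂ ℓ} (F : Family m k₂ ℓ) (D : Subset ℓ) →
  ∣ D ∣ ≤ k₁ → k₁ ≤ ℓ → (∀ i → ∃ λ x → x ∈ D × x ∈ set F i) → PropertyA k₁ F
propertyA-from-transversal F D ∣D∣≤k₁ k₁≤ℓ D-meets-F
  with T , D⊆T , ∣T∣≡k₁ ← superset-of-size D ∣D∣≤k₁ k₁≤ℓ =
  T , ∣T∣≡k₁ , λ i → let x , x∈D , x∈Fi = D-meets-F i in x , x∈p∩q⁺ (D⊆T x∈D , x∈Fi)

Combination : ℕ → ℕ → Set
Combination n k = Σ (Fin k → Fin n) (Injective _≡_ _≡_)

Inside : Subset n → Combination n k → Set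
Inside D (c , _) = ∀ j → c j ∈ D

∅ : Combination n 0
∅ = (λ ()) , λ { {()} }

withZero : Combination n k → Combination (suc n) (suc k)
withZero (c , c-injective) = c₀ , c₀-injective
  where
  c₀ : Fin (suc _) → Fin (suc _)
  c₀ fzero    = fzero
  c₀ (fsuc j) = fsuc (c j)
  c₀-injective : Injective _≡_ _≡_ c₀
  c₀-injective {fzero}  {fzero}  _ = refl
  c₀-injective {fzero}  {fsuc _} ()
  c₀-injective {fsuc _} {fzero}  ()
  c₀-injective {fsuc i} {fsuc j} e = cong fsuc (c-injective (fsuc-injective e))

withoutZero : Combination n k → Combination (suc n) k
withoutZero (c , c-injective) = fsuc ∘ c , c-injective ∘ fsuc-injective

combinations : ∀ n k → List (Combination n k)
combinations n       zero    = [ ∅ ]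
combinations zero    (suc k) = []
combinations (suc n) (suc k) = map withZero (combinations n k) ++ map withoutZero (combinations n (suc k))

length-combinations : ∀ n k → length (combinations n k) ≡ n C k
length-combinations zero    zero    = refl
length-combinations (suc n) zero    = refl
length-combinations zero    (suc k) = refl
length-combinations (suc n) (suc k) = begin
  length (map withZero (combinations n k) ++ map withoutZero (combinations n (suc k)))
    ≡⟨ length-++ (map withZero (combinations n k)) ⟩
  length (map withZero (combinations n k)) + length (map withoutZero (combinations n (suc k)))
    ≡⟨ cong₂ _+_ (length-map withZero (combinations n k)) (length-map withoutZero (combinations n (suc k))) ⟩
  length (combinations n k) + length (combinations n (suc k))
    ≡⟨ cong₂ _+_ (length-combinations n k) (length-combinations n (suc k)) ⟩
  n C k + n C suc k
    ≡⟨ nCk+nC[k+1]≡[n+1]C[k+1] n k ⟩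
  suc n C suc k ∎

combination-inside : (D : Subset n) → k ≤ ∣ D ∣ → Any (Inside D) (combinations n k)
combination-inside {k = zero} D _ = here λ ()
combination-inside {n = suc n} {k = suc k} (inside ∷ D) (s≤s k≤∣D∣) =
  ++⁺ˡ (map⁺ (Any.map (λ {c} → extend {c}) (combination-inside D k≤∣D∣)))
  where
  extend : {c : Combination n k} → Inside D c → Inside (inside ∷ D) (withZero c)
  extend c⊆D fzero    = here
  extend c⊆D (fsuc j) = there (c⊆D j)
combination-inside {k = suc k} (outside ∷ D) k≤∣D∣ =
  ++⁺ʳ (map withZero (combinations _ k))
       (map⁺ (Any.map (λ c⊆D → there ∘ c⊆D) (combination-inside D k≤∣D∣)))

members : (D : Subset n) → ∣ D ∣ ≡ k → Σ (Combination n k) (Inside D)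
members D ∣D∣≡k = satisfied (combination-inside D (≤-reflexive (sym ∣D∣≡k)))

combinationAt : Fin (n C k) → Combination n k
combinationAt {n} {k} = lookup (combinations n k) ∘ cast (sym (length-combinations n k))

combinationAt-inside : (D : Subset n) → k ≤ ∣ D ∣ → ∃ λ u → Inside D (combinationAt {k = k} u)
combinationAt-inside {n} {k} D k≤∣D∣ =
  cast n≡ (index c⊆D) ,
  subst (Inside D ∘ lookup (combinations n k))
        (sym (cast-involutive (sym n≡) n≡ (index c⊆D)))
        (lookup-index c⊆D)
  where
  n≡ = length-combinations n k
  c⊆D = combination-inside D k≤∣D∣

colour : Fin n → ℕ
colour x = suc (toℕ x)

colourList : Combination n k → ListOf k
colourList (c , c-injective) = record
  { col      = colour ∘ c
  ; distinct = c-injective ∘ toℕ-injective ∘ suc-injective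
  ; positive = λ _ → s≤s z≤n
  }

memberList : ∀ {m} → Family m k n → Fin m → ListOf k
memberList F v = colourList (proj₁ (members (set F v) (size F v)))

∈memberList⇒member : ∀ {m c} (F : Family m k n) v → c ∈L memberList F v →
  ∃ λ x → colour x ≡ c × x ∈ set F v
∈memberList⇒member F v (j , colour≡c) =
  let (f , _) , f⊆Fv = members (set F v) (size F v) in f j , colour≡c , f⊆Fv j

unusedColours : ∀ {a} → (Fin a → ℕ) → Subset n
unusedColours c = subset (λ x → ¬? (any? λ u → c u ≟ colour x))

unusedColours-small : (c : Fin (n C k) → ℕ) → (∀ u → c u ∈L colourList (combinationAt u)) →
  ∣ unusedColours {n} c ∣ < k
unusedColours-small {n} {k} c c∈L with k ≤? ∣ unusedColours {n} c ∣
... | no k≰∣U∣ = ≰⇒> k≰∣U∣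
... | yes k≤∣U∣ with u , u⊆U ← combinationAt-inside _ k≤∣U∣ with j , colour≡c ← c∈L u =
  ⊥-elim (∈-subset⁻ _ (u⊆U j) (u , sym colour≡c))

corollary4p1 : (kA kB ℓ : ℕ) → 2 ≤ kA → 2 ≤ kB → kA + kB ∸ 1 ≤ ℓ →
    (m : ℕ) → IsMbar (kA ∸ 1) kB ℓ m →
    ¬ Choosable kA kB (K (ℓ C kA) m)
corollary4p1 (suc a) kB ℓ (s≤s _) _ a+kB≤ℓ m ((F , ¬A) , _) choosable
  with cA , cB , cA∈L , cB∈L , proper ← choosable (colourList ∘ combinationAt {ℓ}) (memberList F) =
  ¬A (propertyA-from-transversal F (unusedColours cA)
       (≤-pred (unusedColours-small {ℓ} cA cA∈L)) (≤-trans (m≤m+n a kB) a+kB≤ℓ) B-colours-unused)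
  where
  B-colours-unused : ∀ v → ∃ λ x → x ∈ unusedColours cA × x ∈ set F v
  B-colours-unused v with x , colour≡cB , x∈Fv ← ∈memberList⇒member F v (cB∈L v) =
    x , ∈-subset⁺ _ (λ (u , cA≡colour) → proper u v tt (trans cA≡colour colour≡cB)) , x∈Fv
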